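{- Let $I_1$ be an instance of the splittable setup model, $\varepsilon\in(0,1)$ with $1/\varepsilon\in\mathbb{Z}$, and $T>0$, such that every job satisfies $\varepsilon T\le s_j\le T$. Let $I_2$ be obtained by setting $\bar p_j=\lceil p_j/(\varepsilon^2T)\rceil\varepsilon^2T$ and $\bar s_j=\lceil s_j/(\varepsilon^2T)\rceil\varepsilon^2T$ for each job $j$. Then for all $L'$: if there is a $(T,L')$-schedule for $I_1$, there is also a $((1+2\varepsilon)T,L')$-schedule for $I_2$ in which the length (processing time) of each job part is a multiple of $\varepsilon^2T$; and for all $T'$, any $(T',L')$-schedule for $I_2$ yields a $(T',L')$-schedule for $I_1$.
   Context: Splittable setup model: jobs with processing times $p_j>0$ and setup times $s_j>0$, $m$ identical machines. A schedule splits each job $j$ into finitely many parts, the $k$-th of processing length $\lambda_j(k)p_j$ with $\lambda_j(k)\in(0,1]$ and $\sum_k\lambda_j(k)=1$, and assigns each part to a machine; a part contributes $s_j+\lambda_j(k)p_j$ to the load of its machine. The makespan is the maximum load. A $(T',L')$-schedule is a schedule with makespan at most $T'$ and free space $\sum_{i\in[m]}(T'-\text{load}_i)\ge L'$.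
   Formalization: The processing times $p_j$, setup times $s_j$, the numbers ε, T, T' and L', and the split fractions $\lambda_j(k)$ of every schedule take values in ℚ. -}

module Defs where

open import Data.Nat using (ℕ; zero; suc)
open import Data.Fin using (Fin; zero; suc)
open import Data.Fin.Properties using () renaming (_≟_ to _≟ᶠ_)
open import Data.Integer using (ℤ)
open import Data.Rational using (ℚ; 0ℚ; 1ℚ; _+_; _-_; _*_; _÷_; _/_; _≤_; _<_; >-nonZero; ceiling)
open import Data.Rational.Properties using (_<?_)
open import Data.List using (List; []; _∷_)
open import Data.List.Relation.Unary.All using (All)
open import Data.Product using (_×_; _,_; proj₁; proj₂)
open import Relation.Nullary using (yes; no; does)
open import Relation.Binary.PropositionalEquality using (_≡_)
open import Data.Bool using (if_then_else_)

sumFin : (n : ℕ) → (Fin n → ℚ) → ℚ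
sumFin zero    f = 0ℚ
sumFin (suc n) f = f zero + sumFin n (λ i → f (suc i))

sumList : List ℚ → ℚ
sumList []       = 0ℚ
sumList (x ∷ xs) = x + sumList xs

-- A job part: (fraction λ_j(k), machine it is assigned to).
Part : ℕ → Set
Part m = ℚ × Fin m

Schedule : ℕ → ℕ → Set
Schedule n m = Fin n → List (Part m)

ValidSchedule : {n m : ℕ} → Schedule n m → Set
ValidSchedule {n} σ =
  (j : Fin n) → All (λ pt → (0ℚ < proj₁ pt) × (proj₁ pt ≤ 1ℚ)) (σ j) × (sumList (Data.List.map proj₁ (σ j)) ≡ 1ℚ)
  where import Data.List

jobLoad : {m : ℕ} → ℚ → ℚ → List (Part m) → Fin m → ℚ
jobLoad sj pj []              i = 0ℚ
jobLoad sj pj ((l , i') ∷ ps) i =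
  (if does (i' ≟ᶠ i) then sj + l * pj else 0ℚ) + jobLoad sj pj ps i

load : {n m : ℕ} → (p s : Fin n → ℚ) → Schedule n m → Fin m → ℚ
load {n} p s σ i = sumFin n (λ j → jobLoad (s j) (p j) (σ j) i)

IsTLSchedule : {n m : ℕ} → (p s : Fin n → ℚ) → (T' L' : ℚ) → Schedule n m → Set
IsTLSchedule {n} {m} p s T' L' σ =
  ValidSchedule σ × ((i : Fin m) → load p s σ i ≤ T') × (L' ≤ sumFin m (λ i → T' - load p s σ i))

-- ⌈x/u⌉·u (for u > 0; the u ≤ 0 branch is a dummy never used in the lemma)
roundUp : ℚ → ℚ → ℚ
roundUp x u with 0ℚ <? u
... | yes u>0 = (ceiling ((x ÷ u) {{>-nonZero u>0}}) / 1) * u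
... | no _    = x

MultipleOf : ℚ → ℚ → Set
MultipleOf q u = Data.Product.∃ λ (z : ℤ) → q ≡ (z / 1) * u
  where import Data.Product

module Submission where

-- Rounding p and s up only increases loads, so a schedule of the rounded instance also serves the
-- original one.  Conversely, lay the parts of a job end to end and move every cut point a to
-- R a = ⌈a/u⌉u: the part [a, a + λp] becomes [R a, R (a + λp)], whose length is a multiple of u and
-- exceeds λp by less than u, while the setup time also grows by less than u (empty parts are dropped).
-- As u = ε (ε T) ≤ ε s_j, each part's contribution s_j + λp_j grows by a factor of at most 1 + 2ε.

open import Defs
open import Data.Nat using (ℕ; zero; suc)
open import Data.Nat.Coprimality using (1-coprimeTo)
import Data.Nat.Coprimality as Coprime
open import Data.Integer as ℤ using (ℤ; +_; +[1+_])
import Data.Integer.Properties as ℤ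
open import Data.Integer.DivMod using (div-pos-is-/ℕ; [n/ℕd]*d≤n; n<s[n/ℕd]*d)
open import Data.Rational
open import Data.Rational.Properties
open import Data.Rational.Solver using (module +-*-Solver)
open import Data.Fin using (Fin; zero; suc)
open import Data.Fin.Properties using () renaming (_≟_ to _≟ᶠ_)
open import Data.List using (List; []; _∷_; map)
open import Data.List.Relation.Unary.All as All using (All; []; _∷_)
open import Data.Product using (∃; _×_; _,_; proj₁; proj₂)
open import Data.Empty using (⊥-elim)
open import Relation.Nullary using (yes; no)
open import Relation.Binary.PropositionalEquality
open import Function using (_∘_)

open +-*-Solver

/1≡mkℚ : ∀ z → z / 1 ≡ mkℚ z 0 (Coprime.sym (1-coprimeTo ℤ.∣ z ∣))
/1≡mkℚ z = ↥p/↧p≡p (mkℚ z 0 _)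

neg-/1 : ∀ z → - (z / 1) ≡ (ℤ.- z) / 1
neg-/1 z rewrite /1≡mkℚ z | /1≡mkℚ (ℤ.- z) with z
... | + zero   = refl
... | +[1+ _ ] = refl
... | ℤ.-[1+ _ ] = refl

+-/1 : ∀ a b → a / 1 + b / 1 ≡ (a ℤ.+ b) / 1
+-/1 a b rewrite /1≡mkℚ a | /1≡mkℚ b =
  cong₂ (λ x y → (x ℤ.+ y) / 1) (ℤ.*-identityʳ a) (ℤ.*-identityʳ b)

/1-mono-≤ : ∀ {a b} → a ℤ.≤ b → a / 1 ≤ b / 1
/1-mono-≤ {a} {b} a≤b = subst₂ _≤_ (sym (/1≡mkℚ a)) (sym (/1≡mkℚ b))
  (*≤* (subst₂ ℤ._≤_ (sym (ℤ.*-identityʳ a)) (sym (ℤ.*-identityʳ b)) a≤b))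

/1-cancel-< : ∀ {a b} → a / 1 < b / 1 → a ℤ.< b
/1-cancel-< {a} {b} a<b rewrite /1≡mkℚ a | /1≡mkℚ b with a<b
... | *<* a*1<b*1 = subst₂ ℤ._<_ (ℤ.*-identityʳ a) (ℤ.*-identityʳ b) a*1<b*1

floor-≤ : ∀ q → floor q / 1 ≤ q
floor-≤ (mkℚ n d-1 c) = subst (_≤ mkℚ n d-1 c) (sym (/1≡mkℚ (n ℤ./ +[1+ d-1 ])))
  (*≤* (subst₂ ℤ._≤_ (cong (ℤ._* +[1+ d-1 ]) (sym (div-pos-is-/ℕ n (suc d-1))))
                     (sym (ℤ.*-identityʳ n))
                     ([n/ℕd]*d≤n n (suc d-1))))

<-suc-floor : ∀ q → q < ℤ.suc (floor q) / 1
<-suc-floor (mkℚ n d-1 c) = subst (mkℚ n d-1 c <_) (sym (/1≡mkℚ (ℤ.suc (n ℤ./ +[1+ d-1 ]))))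
  (*<* (subst₂ ℤ._<_ (sym (ℤ.*-identityʳ n))
                     (cong (λ x → ℤ.suc x ℤ.* +[1+ d-1 ]) (sym (div-pos-is-/ℕ n (suc d-1))))
                     (n<s[n/ℕd]*d n (suc d-1))))

ceiling≡-floor-neg : ∀ q → ceiling q ≡ ℤ.- floor (- q)
ceiling≡-floor-neg (mkℚ _ _ _) = refl

neg-involutive : ∀ q → - (- q) ≡ q
neg-involutive = solve 1 (λ q → :- (:- q) := q) refl

≤-ceiling : ∀ q → q ≤ ceiling q / 1
≤-ceiling q = subst₂ _≤_ (neg-involutive q)
  (trans (neg-/1 (floor (- q))) (cong (_/ 1) (sym (ceiling≡-floor-neg q))))
  (neg-antimono-≤ (floor-≤ (- q)))

ceiling-<-+1 : ∀ q → ceiling q / 1 < q + 1ℚ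
ceiling-<-+1 q = subst (_< q + 1ℚ) shifted (+-monoˡ-< 1ℚ
  (subst (- (ℤ.suc (floor (- q)) / 1) <_) (neg-involutive q) (neg-antimono-< (<-suc-floor (- q)))))
  where
  open ≡-Reasoning
  f = floor (- q)
  shifted : - (ℤ.suc f / 1) + 1ℚ ≡ ceiling q / 1
  shifted = begin
    - (ℤ.suc f / 1) + 1ℚ   ≡⟨ cong (λ x → - x + 1ℚ) (sym (+-/1 (+ 1) f)) ⟩
    - (1ℚ + f / 1) + 1ℚ    ≡⟨ solve 1 (λ x → :- (con 1ℚ :+ x) :+ con 1ℚ := :- x) refl (f / 1) ⟩
    - (f / 1)              ≡⟨ neg-/1 f ⟩
    (ℤ.- f) / 1            ≡⟨ cong (_/ 1) (sym (ceiling≡-floor-neg q)) ⟩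
    ceiling q / 1          ∎

ceiling-mono-≤ : ∀ {a b} → a ≤ b → ceiling a ℤ.≤ ceiling b
ceiling-mono-≤ {a} {b} a≤b = subst (ceiling a ℤ.≤_) (ℤ.pred-suc (ceiling b))
  (ℤ.i<j⇒i≤pred[j] (/1-cancel-< {ceiling a} {ℤ.suc (ceiling b)} (begin-strict
    ceiling a / 1           <⟨ ceiling-<-+1 a ⟩
    a + 1ℚ                  ≤⟨ +-monoˡ-≤ 1ℚ (≤-trans a≤b (≤-ceiling b)) ⟩
    ceiling b / 1 + 1ℚ      ≡⟨ +-comm (ceiling b / 1) 1ℚ ⟩
    1ℚ + ceiling b / 1      ≡⟨ +-/1 (+ 1) (ceiling b) ⟩
    ℤ.suc (ceiling b) / 1   ∎)))
  where open ≤-Reasoning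

÷-*-cancel : ∀ x y .{{_ : NonZero y}} → (x ÷ y) * y ≡ x
÷-*-cancel x y = trans (*-assoc x (1/ y) y) (trans (cong (x *_) (*-inverseˡ y)) (*-identityʳ x))

module RoundUp (u : ℚ) (u>0 : 0ℚ < u) where
  instance
    u≢0 : NonZero u
    u≢0 = >-nonZero u>0
    u⁺ : Positive u
    u⁺ = positive u>0

  private
    u⁰ : NonNegative u
    u⁰ = pos⇒nonNeg u

    ⌈_⌉ᵤ : ℚ → ℤ
    ⌈ x ⌉ᵤ = ceiling (x ÷ u)

  roundUp≡ : ∀ x → roundUp x u ≡ (⌈ x ⌉ᵤ / 1) * u
  roundUp≡ x with 0ℚ <? u
  ... | yes _   = refl
  ... | no u≯0 = ⊥-elim (u≯0 u>0)

  ≤-roundUp : ∀ x → x ≤ roundUp x u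
  ≤-roundUp x = subst₂ _≤_ (÷-*-cancel x u) (sym (roundUp≡ x))
    (*-monoʳ-≤-nonNeg u {{u⁰}} (≤-ceiling (x ÷ u)))

  roundUp-<-+ : ∀ x → roundUp x u < x + u
  roundUp-<-+ x = subst₂ _<_ (sym (roundUp≡ x)) expand (*-monoˡ-<-pos u (ceiling-<-+1 (x ÷ u)))
    where
    expand : (x ÷ u + 1ℚ) * u ≡ x + u
    expand = trans (*-distribʳ-+ u (x ÷ u) 1ℚ) (cong₂ _+_ (÷-*-cancel x u) (*-identityˡ u))

  roundUp-mono-≤ : ∀ {a b} → a ≤ b → roundUp a u ≤ roundUp b u
  roundUp-mono-≤ {a} {b} a≤b = subst₂ _≤_ (sym (roundUp≡ a)) (sym (roundUp≡ b))
    (*-monoʳ-≤-nonNeg u {{u⁰}} (/1-mono-≤ (ceiling-mono-≤ {a ÷ u} {b ÷ u}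
      (*-cancelʳ-≤-pos u (subst₂ _≤_ (sym (÷-*-cancel a u)) (sym (÷-*-cancel b u)) a≤b)))))

  roundUp-0 : roundUp 0ℚ u ≡ 0ℚ
  roundUp-0 = trans (roundUp≡ 0ℚ) (trans (cong (λ z → (ceiling z / 1) * u) (*-zeroˡ (1/ u))) (*-zeroˡ u))

  roundUp-difference-multiple : ∀ a b → MultipleOf (roundUp a u - roundUp b u) u
  roundUp-difference-multiple a b = ⌈ a ⌉ᵤ ℤ.- ⌈ b ⌉ᵤ , (begin
    roundUp a u - roundUp b u                 ≡⟨ cong₂ _-_ (roundUp≡ a) (roundUp≡ b) ⟩
    (⌈ a ⌉ᵤ / 1) * u - (⌈ b ⌉ᵤ / 1) * u       ≡⟨ solve 3 (λ x y u → x :* u :- y :* u := (x :+ :- y) :* u) refl (⌈ a ⌉ᵤ / 1) (⌈ b ⌉ᵤ / 1) u ⟩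
    (⌈ a ⌉ᵤ / 1 + - (⌈ b ⌉ᵤ / 1)) * u         ≡⟨ cong (λ z → (⌈ a ⌉ᵤ / 1 + z) * u) (neg-/1 ⌈ b ⌉ᵤ) ⟩
    (⌈ a ⌉ᵤ / 1 + (ℤ.- ⌈ b ⌉ᵤ) / 1) * u       ≡⟨ cong (_* u) (+-/1 ⌈ a ⌉ᵤ (ℤ.- ⌈ b ⌉ᵤ)) ⟩
    ((⌈ a ⌉ᵤ ℤ.- ⌈ b ⌉ᵤ) / 1) * u             ∎)
    where open ≡-Reasoning

  roundUp-+-increment-≤ : ∀ s a x → roundUp s u + (roundUp (a + x) u - roundUp a u) ≤ (s + x) + (u + u)
  roundUp-+-increment-≤ s a x = begin
    roundUp s u + (roundUp (a + x) u - roundUp a u)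
      ≤⟨ +-mono-≤ (<⇒≤ (roundUp-<-+ s)) (+-mono-≤ (<⇒≤ (roundUp-<-+ (a + x))) (neg-antimono-≤ (≤-roundUp a))) ⟩
    (s + u) + ((a + x + u) - a)
      ≡⟨ solve 4 (λ s u a x → (s :+ u) :+ ((a :+ x :+ u) :- a) := (s :+ x) :+ (u :+ u)) refl s u a x ⟩
    (s + x) + (u + u) ∎
    where open ≤-Reasoning

sumFin-mono-≤ : ∀ n {f g : Fin n → ℚ} → (∀ i → f i ≤ g i) → sumFin n f ≤ sumFin n g
sumFin-mono-≤ zero    f≤g = ≤-refl
sumFin-mono-≤ (suc n) f≤g = +-mono-≤ (f≤g zero) (sumFin-mono-≤ n (λ i → f≤g (suc i)))

*-distribˡ-sumFin : ∀ n c (f : Fin n → ℚ) → c * sumFin n f ≡ sumFin n (λ i → c * f i)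
*-distribˡ-sumFin zero    c f = *-zeroʳ c
*-distribˡ-sumFin (suc n) c f = trans (*-distribˡ-+ c (f zero) _)
  (cong (λ r → c * f zero + r) (*-distribˡ-sumFin n c (λ i → f (suc i))))

p≤p+q : ∀ a {b} → 0ℚ ≤ b → a ≤ a + b
p≤p+q a {b} 0≤b = subst (_≤ a + b) (+-identityʳ a) (+-monoʳ-≤ a 0≤b)

totalFraction : ∀ {m} → List (Part m) → ℚ
totalFraction ps = sumList (map proj₁ ps)

PositiveParts : ∀ {m} → List (Part m) → Set
PositiveParts = All (λ pt → 0ℚ < proj₁ pt)

totalFraction-nonNeg : ∀ {m} {ps : List (Part m)} → PositiveParts ps → 0ℚ ≤ totalFraction ps
totalFraction-nonNeg []         = ≤-refl
totalFraction-nonNeg (l>0 ∷ ps⁺) = +-mono-≤ (<⇒≤ l>0) (totalFraction-nonNeg ps⁺)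

fraction-≤-totalFraction : ∀ {m} {ps : List (Part m)} → PositiveParts ps →
                           All (λ pt → proj₁ pt ≤ totalFraction ps) ps
fraction-≤-totalFraction []                         = []
fraction-≤-totalFraction {ps = (l , _) ∷ ps} (l>0 ∷ ps⁺) =
  p≤p+q l (totalFraction-nonNeg ps⁺) ∷ All.map (λ ≤rest → ≤-trans ≤rest rest≤) (fraction-≤-totalFraction ps⁺)
  where
  rest≤ : totalFraction ps ≤ l + totalFraction ps
  rest≤ = subst (_≤ l + totalFraction ps) (+-identityˡ _) (+-monoˡ-≤ _ (<⇒≤ l>0))

validParts : ∀ {m} {ps : List (Part m)} → PositiveParts ps → totalFraction ps ≡ 1ℚ →
             All (λ pt → (0ℚ < proj₁ pt) × (proj₁ pt ≤ 1ℚ)) ps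
validParts ps⁺ total≡1 =
  All.zipWith (λ (l>0 , l≤total) → l>0 , subst (_ ≤_) total≡1 l≤total) (ps⁺ , fraction-≤-totalFraction ps⁺)

jobLoad-mono-≤ : ∀ {m s s' p p'} → s ≤ s' → p ≤ p' → {ps : List (Part m)} → PositiveParts ps →
                 ∀ i → jobLoad s p ps i ≤ jobLoad s' p' ps i
jobLoad-mono-≤ s≤s' p≤p' []                                   i = ≤-refl
jobLoad-mono-≤ s≤s' p≤p' {(l , i') ∷ _} (l>0 ∷ ps⁺) i with i' ≟ᶠ i
... | yes _ = +-mono-≤ (+-mono-≤ s≤s' (*-monoˡ-≤-nonNeg l {{nonNegative (<⇒≤ l>0)}} p≤p'))
                       (jobLoad-mono-≤ s≤s' p≤p' ps⁺ i)
... | no _  = +-monoʳ-≤ 0ℚ (jobLoad-mono-≤ s≤s' p≤p' ps⁺ i)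

load-mono-≤ : ∀ {n m} {p p' s s' : Fin n → ℚ} {σ : Schedule n m} → ValidSchedule σ →
              (∀ j → p j ≤ p' j) → (∀ j → s j ≤ s' j) → ∀ i → load p s σ i ≤ load p' s' σ i
load-mono-≤ {n} valid p≤p' s≤s' i = sumFin-mono-≤ n λ j →
  jobLoad-mono-≤ (s≤s' j) (p≤p' j) (All.map proj₁ (proj₁ (valid j))) i

IsTLSchedule-dominated : ∀ {n n' m} {p s : Fin n → ℚ} {p' s' : Fin n' → ℚ} {T L K : ℚ}
                           {σ : Schedule n m} {σ' : Schedule n' m} →
                         1ℚ ≤ K → ValidSchedule σ' → (∀ i → load p' s' σ' i ≤ K * load p s σ i) →
                         IsTLSchedule p s T L σ → IsTLSchedule p' s' (K * T) L σ'
IsTLSchedule-dominated {m = m} {p} {s} {p'} {s'} {T} {L} {K} {σ} {σ'} 1≤K valid' dominated (_ , fits , free) =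
  valid' , fits' , ≤-trans free (sumFin-mono-≤ m free-≤)
  where
  K⁰ : NonNegative K
  K⁰ = nonNegative (≤-trans (nonNegative⁻¹ 1ℚ) 1≤K)

  fits' : ∀ i → load p' s' σ' i ≤ K * T
  fits' i = ≤-trans (dominated i) (*-monoˡ-≤-nonNeg K {{K⁰}} (fits i))

  free-≤ : ∀ i → T - load p s σ i ≤ K * T - load p' s' σ' i
  free-≤ i = begin
    T - ℓ              ≡⟨ sym (*-identityˡ (T - ℓ)) ⟩
    1ℚ * (T - ℓ)       ≤⟨ *-monoʳ-≤-nonNeg (T - ℓ) {{nonNegative slack≥0}} 1≤K ⟩
    K * (T - ℓ)        ≡⟨ solve 3 (λ k t l → k :* (t :- l) := k :* t :- k :* l) refl K T ℓ ⟩
    K * T - K * ℓ      ≤⟨ +-monoʳ-≤ (K * T) (neg-antimono-≤ (dominated i)) ⟩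
    K * T - load p' s' σ' i ∎
    where
    open ≤-Reasoning
    ℓ = load p s σ i
    slack≥0 : 0ℚ ≤ T - ℓ
    slack≥0 = subst (_≤ T - ℓ) (+-inverseʳ ℓ) (+-monoˡ-≤ (- ℓ) (fits i))

IsTLSchedule-antimono : ∀ {n m} {p p' s s' : Fin n → ℚ} {T L : ℚ} {σ : Schedule n m} →
                        (∀ j → p j ≤ p' j) → (∀ j → s j ≤ s' j) →
                        IsTLSchedule p' s' T L σ → IsTLSchedule p s T L σ
IsTLSchedule-antimono {p = p} {p'} {s} {s'} {T} {L} {σ} p≤p' s≤s' sched@(valid , _) =
  subst (λ t → IsTLSchedule p s t L σ) (*-identityˡ T) (IsTLSchedule-dominated ≤-refl valid dominated sched)
  where
  dominated : ∀ i → load p s σ i ≤ 1ℚ * load p' s' σ i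
  dominated i = subst (_ ≤_) (sym (*-identityˡ _)) (load-mono-≤ valid p≤p' s≤s' i)

module Regrid {m : ℕ} (R : ℚ → ℚ) (R-mono-≤ : ∀ {a b} → a ≤ b → R a ≤ R b)
              (p : ℚ) (p>0 : 0ℚ < p) (Rp>0 : 0ℚ < R p) where
  instance
    Rp≢0 : NonZero (R p)
    Rp≢0 = >-nonZero Rp>0

  *p-nonNeg : ∀ {l} → 0ℚ < l → 0ℚ ≤ l * p
  *p-nonNeg {l} l>0 = <⇒≤ (subst (_< l * p) (*-zeroˡ p) (*-monoˡ-<-pos p {{positive p>0}} l>0))

  increment : ℚ → ℚ → ℚ
  increment a l = R (a + l * p) - R a

  increment-nonNeg : ∀ a {l} → 0ℚ < l → 0ℚ ≤ increment a l
  increment-nonNeg a {l} l>0 = subst (_≤ increment a l) (+-inverseʳ (R a))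
    (+-monoˡ-≤ (- R a) (R-mono-≤ (p≤p+q a (*p-nonNeg l>0))))

  -- The first argument is the position in the job at which the given parts start.
  regrid : ℚ → List (Part m) → List (Part m)
  regrid a []            = []
  regrid a ((l , i) ∷ ps) with 0ℚ <? increment a l
  ... | yes _ = (increment a l ÷ R p , i) ∷ regrid (a + l * p) ps
  ... | no _  = regrid (a + l * p) ps

  regrid-positive : ∀ a ps → PositiveParts (regrid a ps)
  regrid-positive a []            = []
  regrid-positive a ((l , i) ∷ ps) with 0ℚ <? increment a l
  ... | yes δ>0 = *-cancelʳ-<-nonNeg (R p) {{nonNegative (<⇒≤ Rp>0)}}
                    (subst₂ _<_ (sym (*-zeroˡ (R p))) (sym (÷-*-cancel (increment a l) (R p))) δ>0)
                  ∷ regrid-positive (a + l * p) ps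
  ... | no _    = regrid-positive (a + l * p) ps

  regrid-multiple : ∀ {u} → (∀ a b → MultipleOf (R a - R b) u) →
                    ∀ a ps → All (λ pt → MultipleOf (proj₁ pt * R p) u) (regrid a ps)
  regrid-multiple R-multiple a []            = []
  regrid-multiple R-multiple a ((l , i) ∷ ps) with 0ℚ <? increment a l
  ... | yes _ = (proj₁ (R-multiple (a + l * p) a) ,
                 trans (÷-*-cancel (increment a l) (R p)) (proj₂ (R-multiple (a + l * p) a)))
                ∷ regrid-multiple R-multiple (a + l * p) ps
  ... | no _  = regrid-multiple R-multiple (a + l * p) ps

  regrid-totalFraction : ∀ a {ps} → PositiveParts ps →
                         totalFraction (regrid a ps) ≡ (R (a + totalFraction ps * p) - R a) ÷ R p
  regrid-totalFraction a []                           =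
    sym (trans (cong (λ x → (R x - R a) ÷ R p) (solve 2 (λ a p → a :+ con 0ℚ :* p := a) refl a p))
               (solve 2 (λ x q → (x :- x) :* q := con 0ℚ) refl (R a) (1/ R p)))
  regrid-totalFraction a {(l , i) ∷ ps} (l>0 ∷ ps⁺) with 0ℚ <? increment a l
  ... | yes _ = begin
    (R c - R a) ÷ R p + totalFraction (regrid c ps)     ≡⟨ cong (λ x → (R c - R a) ÷ R p + x) (regrid-totalFraction c ps⁺) ⟩
    (R c - R a) ÷ R p + (R (c + S * p) - R c) ÷ R p     ≡⟨ cong (λ x → (R c - R a) ÷ R p + (R x - R c) ÷ R p) c+Sp≡ ⟩
    (R c - R a) ÷ R p + (R b - R c) ÷ R p               ≡⟨ solve 4 (λ x y z q → (y :- x) :* q :+ (z :- y) :* q := (z :- x) :* q) refl (R a) (R c) (R b) (1/ R p) ⟩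
    (R b - R a) ÷ R p                                   ∎
    where
    open ≡-Reasoning
    c = a + l * p
    S = totalFraction ps
    b = a + (l + S) * p
    c+Sp≡ : c + S * p ≡ b
    c+Sp≡ = solve 4 (λ a l s p → (a :+ l :* p) :+ s :* p := a :+ (l :+ s) :* p) refl a l S p
  ... | no δ≯0 = begin
    totalFraction (regrid c ps)          ≡⟨ regrid-totalFraction c ps⁺ ⟩
    (R (c + S * p) - R c) ÷ R p          ≡⟨ cong₂ (λ x y → (R x - y) ÷ R p) c+Sp≡ Rc≡Ra ⟩
    (R b - R a) ÷ R p                    ∎
    where
    open ≡-Reasoning
    c = a + l * p
    S = totalFraction ps
    b = a + (l + S) * p
    c+Sp≡ : c + S * p ≡ b
    c+Sp≡ = solve 4 (λ a l s p → (a :+ l :* p) :+ s :* p := a :+ (l :+ s) :* p) refl a l S p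
    Rc≡Ra : R c ≡ R a
    Rc≡Ra = trans (solve 2 (λ x y → x := (x :- y) :+ y) refl (R c) (R a))
                  (trans (cong (_+ R a) (≤-antisym (≮⇒≥ δ≯0) (increment-nonNeg a l>0))) (+-identityˡ (R a)))

  regrid-totalFraction-whole : R 0ℚ ≡ 0ℚ → ∀ {ps} → PositiveParts ps → totalFraction ps ≡ 1ℚ →
                               totalFraction (regrid 0ℚ ps) ≡ 1ℚ
  regrid-totalFraction-whole R0≡0 {ps} ps⁺ total≡1 = begin
    totalFraction (regrid 0ℚ ps)                   ≡⟨ regrid-totalFraction 0ℚ ps⁺ ⟩
    (R (0ℚ + totalFraction ps * p) - R 0ℚ) ÷ R p   ≡⟨ cong₂ (λ x y → (R x - y) ÷ R p) 0+1*p≡p R0≡0 ⟩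
    (R p - 0ℚ) ÷ R p                               ≡⟨ cong (_÷ R p) (solve 1 (λ x → x :- con 0ℚ := x) refl (R p)) ⟩
    R p ÷ R p                                      ≡⟨ *-inverseʳ (R p) ⟩
    1ℚ                                             ∎
    where
    open ≡-Reasoning
    0+1*p≡p : 0ℚ + totalFraction ps * p ≡ p
    0+1*p≡p = trans (cong (λ t → 0ℚ + t * p) total≡1) (solve 1 (λ p → con 0ℚ :+ con 1ℚ :* p := p) refl p)

  regrid-jobLoad-≤ : ∀ {K s s̄} → 0ℚ ≤ s̄ → (∀ a {l} → 0ℚ < l → s̄ + increment a l ≤ K * (s + l * p)) →
                     ∀ a {ps} → PositiveParts ps → ∀ i → jobLoad s̄ (R p) (regrid a ps) i ≤ K * jobLoad s p ps i
  regrid-jobLoad-≤ {K} {s} {s̄} s̄≥0 part-bound = go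
    where
    kept : ∀ {x' x r' r} → x' ≤ K * x → r' ≤ K * r → x' + r' ≤ K * (x + r)
    kept {x' = x'} {x} {r'} {r} x'≤ r'≤ = subst (x' + r' ≤_) (sym (*-distribˡ-+ K x r)) (+-mono-≤ x'≤ r'≤)

    dropped : ∀ {x r' r} → 0ℚ ≤ K * x → r' ≤ K * r → r' ≤ K * (x + r)
    dropped {r' = r'} 0≤ r'≤ = subst (_≤ _) (+-identityˡ r') (kept 0≤ r'≤)

    0≤K*0 : 0ℚ ≤ K * 0ℚ
    0≤K*0 = ≤-reflexive (sym (*-zeroʳ K))

    go : ∀ a {ps} → PositiveParts ps → ∀ i → jobLoad s̄ (R p) (regrid a ps) i ≤ K * jobLoad s p ps i
    go a []                          i = 0≤K*0
    go a {(l , i') ∷ ps} (l>0 ∷ ps⁺) i with 0ℚ <? increment a l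
    ... | yes _ = keptPart
      where
      keptPart : jobLoad s̄ (R p) ((increment a l ÷ R p , i') ∷ regrid (a + l * p) ps) i
                 ≤ K * jobLoad s p ((l , i') ∷ ps) i
      keptPart with i' ≟ᶠ i
      ... | yes _ = kept (subst (λ x → s̄ + x ≤ _) (sym (÷-*-cancel (increment a l) (R p))) (part-bound a l>0))
                         (go (a + l * p) ps⁺ i)
      ... | no _  = kept 0≤K*0 (go (a + l * p) ps⁺ i)
    ... | no _ = droppedPart
      where
      droppedPart : jobLoad s̄ (R p) (regrid (a + l * p) ps) i ≤ K * jobLoad s p ((l , i') ∷ ps) i
      droppedPart with i' ≟ᶠ i
      ... | yes _ = dropped (≤-trans (+-mono-≤ s̄≥0 (increment-nonNeg a l>0)) (part-bound a l>0))
                            (go (a + l * p) ps⁺ i)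
      ... | no _  = dropped 0≤K*0 (go (a + l * p) ps⁺ i)

module _ {ε T : ℚ} (ε>0 : 0ℚ < ε) (T>0 : 0ℚ < T) where
  private instance
    ε⁺ : Positive ε
    ε⁺ = positive ε>0
    T⁺ : Positive T
    T⁺ = positive T>0

  grid>0 : 0ℚ < ε * ε * T
  grid>0 = positive⁻¹ _ {{pos*pos⇒pos (ε * ε) {{pos*pos⇒pos ε ε}} T}}

  open RoundUp (ε * ε * T) grid>0

  private
    u : ℚ
    u = ε * ε * T

    R : ℚ → ℚ
    R x = roundUp x u

    2ε : ℚ
    2ε = + 2 / 1 * ε

    instance
      2ε⁰ : NonNegative 2ε
      2ε⁰ = pos⇒nonNeg 2ε {{pos*pos⇒pos (+ 2 / 1) ε}}

    1≤1+2ε : 1ℚ ≤ 1ℚ + 2ε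
    1≤1+2ε = p≤p+q 1ℚ (nonNegative⁻¹ 2ε)

  roundUp-part-≤ : ∀ {s} → ε * T ≤ s → ∀ a {x} → 0ℚ ≤ x →
                   roundUp s u + (roundUp (a + x) u - roundUp a u) ≤ (1ℚ + 2ε) * (s + x)
  roundUp-part-≤ {s} εT≤s a {x} x≥0 = begin
    roundUp s u + (roundUp (a + x) u - roundUp a u)   ≤⟨ roundUp-+-increment-≤ s a x ⟩
    (s + x) + (u + u)                                 ≡⟨ cong (λ d → (s + x) + d) (solve 2 (λ e t → e :* e :* t :+ e :* e :* t := (con (+ 2 / 1) :* e) :* (e :* t)) refl ε T) ⟩
    (s + x) + 2ε * (ε * T)                            ≤⟨ +-monoʳ-≤ (s + x) (*-monoˡ-≤-nonNeg 2ε (≤-trans εT≤s (p≤p+q s x≥0))) ⟩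
    (s + x) + 2ε * (s + x)                            ≡⟨ solve 2 (λ y k → y :+ k :* y := (con 1ℚ :+ k) :* y) refl (s + x) 2ε ⟩
    (1ℚ + 2ε) * (s + x)                               ∎
    where open ≤-Reasoning

  IsTLSchedule-onGrid : ∀ {n m} {p s : Fin n → ℚ} {L} →
                        (∀ j → 0ℚ < p j) → (∀ j → 0ℚ < s j) → (∀ j → ε * T ≤ s j) →
                        ∃ (IsTLSchedule {n} {m} p s T L) →
                        ∃ λ σ' → IsTLSchedule (R ∘ p) (R ∘ s) ((1ℚ + 2ε) * T) L σ' ×
                                 (∀ j → All (λ pt → MultipleOf (proj₁ pt * R (p j)) u) (σ' j))
  IsTLSchedule-onGrid {n} {m} {p} {s} p>0 s>0 εT≤s (σ , sched@(valid , _)) =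
    σ' , IsTLSchedule-dominated 1≤1+2ε valid' dominated sched ,
    λ j → Job.regrid-multiple j roundUp-difference-multiple 0ℚ (σ j)
    where
    module Job (j : Fin n) = Regrid {m} R roundUp-mono-≤ (p j) (p>0 j) (<-≤-trans (p>0 j) (≤-roundUp (p j)))

    σ' : Schedule n m
    σ' j = Job.regrid j 0ℚ (σ j)

    parts⁺ : ∀ j → PositiveParts (σ j)
    parts⁺ j = All.map proj₁ (proj₁ (valid j))

    total≡1 : ∀ j → totalFraction (σ' j) ≡ 1ℚ
    total≡1 j = Job.regrid-totalFraction-whole j roundUp-0 (parts⁺ j) (proj₂ (valid j))

    valid' : ValidSchedule σ'
    valid' j = validParts (Job.regrid-positive j 0ℚ (σ j)) (total≡1 j) , total≡1 j

    jobDominated : ∀ j i → jobLoad (R (s j)) (R (p j)) (σ' j) i ≤ (1ℚ + 2ε) * jobLoad (s j) (p j) (σ j) i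
    jobDominated j = Job.regrid-jobLoad-≤ j {1ℚ + 2ε} {s j} (<⇒≤ (<-≤-trans (s>0 j) (≤-roundUp (s j))))
      (λ a l>0 → roundUp-part-≤ (εT≤s j) a (Job.*p-nonNeg j l>0)) 0ℚ (parts⁺ j)

    dominated : ∀ i → load (R ∘ p) (R ∘ s) σ' i ≤ (1ℚ + 2ε) * load p s σ i
    dominated i = subst (load (R ∘ p) (R ∘ s) σ' i ≤_)
      (sym (*-distribˡ-sumFin n (1ℚ + 2ε) (λ j → jobLoad (s j) (p j) (σ j) i)))
      (sumFin-mono-≤ n (λ j → jobDominated j i))

lemma12 : (n m : ℕ) (p s : Fin n → ℚ) (ε T : ℚ) →
          ((j : Fin n) → 0ℚ < p j) → ((j : Fin n) → 0ℚ < s j) →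
          0ℚ < ε → ε < 1ℚ → (∃ λ (k : ℤ) → ε * (k / 1) ≡ 1ℚ) →
          0ℚ < T →
          ((j : Fin n) → (ε * T ≤ s j) × (s j ≤ T)) →
          let u = ε * ε * T
              pbar = λ j → roundUp (p j) u
              sbar = λ j → roundUp (s j) u
          in ((L' : ℚ) →
               (∃ λ (σ : Schedule n m) → IsTLSchedule p s T L' σ) →
               ∃ λ (σ' : Schedule n m) →
                 IsTLSchedule pbar sbar ((1ℚ + (+ 2 / 1) * ε) * T) L' σ' ×
                 ((j : Fin n) → All (λ pt → MultipleOf (proj₁ pt * pbar j) u) (σ' j)))
             ×
             ((T' L' : ℚ) →
               (∃ λ (σ' : Schedule n m) → IsTLSchedule pbar sbar T' L' σ') →
               ∃ λ (σ : Schedule n m) → IsTLSchedule p s T' L' σ)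
lemma12 n m p s ε T p>0 s>0 ε>0 _ _ T>0 s-bounds =
  (λ L' → IsTLSchedule-onGrid ε>0 T>0 p>0 s>0 (proj₁ ∘ s-bounds)) ,
  (λ T' L' (σ' , sched) → σ' , IsTLSchedule-antimono (≤-roundUp ∘ p) (≤-roundUp ∘ s) sched)
  where open RoundUp (ε * ε * T) (grid>0 ε>0 T>0)
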